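{- Let $K\subseteq Q$ be a convex cone. If $T(K)+D^{\perp}\supseteq\mathcal{S}_+^{d+1}$, then $N_+^r(K)=N^r(K)$ for every integer $r\ge0$.
   Context: Vectors in $\mathbb{R}^{d+1}$ have coordinates indexed $0,\dots,d$; $e_i$ is the $i$-th unit vector. $Q\subseteq\mathbb{R}^{d+1}$ is the convex cone generated by all $(1,x)$ with $x\in\{0,1\}^d$; for a convex cone $C$, $C^*=\{s:s^Tx\ge0\ \forall x\in C\}$. $\mathcal{S}^{d+1}$ is the space of real symmetric $(d+1)\times(d+1)$ matrices with trace inner product, $\mathcal{S}_+^{d+1}$ its positive semidefinite cone. $M(K)$ is the set of $Y\in\mathcal{S}^{d+1}$ with $Ye_0=\mathrm{diag}(Y)$ and $u^TYv\ge0$ for all $u\in Q^*,v\in K^*$; $M_+(K)=M(K)\cap\mathcal{S}_+^{d+1}$; $N(K)=\{\mathrm{diag}(Y):Y\in M(K)\}$, $N_+(K)=\{\mathrm{diag}(Y):Y\in M_+(K)\}$; $N^0(K)=K$, $N^r(K)=N(N^{r-1}(K))$, similarly $N_+^r$. $T(K)=\mathrm{cone}\{uv^T+vu^T:u\in Q^*,v\in K^*\}$. $D^\perp=\{\sum_{i=1}^d\alpha_i(E_{ii}-E_{0i}):\alpha\in\mathbb{R}^d\}$, where $E_{ij}=e_ie_j^T+e_je_i^T$ (the orthogonal complement of $\{Y\in\mathcal{S}^{d+1}:\mathrm{diag}(Y)=Ye_0\}$). -}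

module Defs where

open import Data.Nat using (ℕ; zero; suc)
open import Data.Fin using (Fin; zero; suc; _≟_)
open import Data.Bool using (if_then_else_)
open import Data.Product using (Σ; ∃; _×_; _,_)
open import Data.Sum using (_⊎_)
open import Relation.Nullary using (does)
open import Relation.Binary.PropositionalEquality using (_≡_; _≢_)
open import Relation.Binary.Structures using (IsTotalOrder)
open import Algebra.Structures using (IsCommutativeRing)

-- The real numbers, axiomatised as a complete (Dedekind / least-upper-bound)
-- ordered field.  Any two models are isomorphic, so quantifying over all
-- models is the same as speaking about ℝ.
record RealField : Set₁ where
  infixl 6 _+_
  infixl 7 _*_
  infix 4 _≤_
  field
    ℝ : Set
    _+_ _*_ : ℝ → ℝ → ℝ
    -_ : ℝ → ℝ
    0ℝ 1ℝ : ℝ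
    _≤_ : ℝ → ℝ → Set
    isCommutativeRing : IsCommutativeRing _≡_ _+_ _*_ -_ 0ℝ 1ℝ
    0≢1 : 0ℝ ≢ 1ℝ
    inverse : ∀ x → x ≢ 0ℝ → ∃ λ y → x * y ≡ 1ℝ
    isTotalOrder : IsTotalOrder _≡_ _≤_
    +-mono-≤ : ∀ {x y} z → x ≤ y → x + z ≤ y + z
    *-nonneg : ∀ {x y} → 0ℝ ≤ x → 0ℝ ≤ y → 0ℝ ≤ x * y
    sup : (P : ℝ → Set) → ∃ P → (∃ λ b → ∀ x → P x → x ≤ b) →
          ∃ λ s → (∀ x → P x → x ≤ s) × (∀ b → (∀ x → P x → x ≤ b) → s ≤ b)

module Cones (R : RealField) (d : ℕ) where
  open RealField R public

  Idx : Set
  Idx = Fin (suc d)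

  Vect : Set
  Vect = Idx → ℝ

  Mat : Set
  Mat = Idx → Idx → ℝ

  Σℝ : (n : ℕ) → (Fin n → ℝ) → ℝ
  Σℝ zero f = 0ℝ
  Σℝ (suc n) f = f zero + Σℝ n (λ i → f (suc i))

  _·_ : Vect → Vect → ℝ
  u · v = Σℝ (suc d) (λ i → u i * v i)

  e : Idx → Vect
  e i j = if does (i ≟ j) then 1ℝ else 0ℝ

  module Conic {A : Set} (zeroA : A) (_⊕_ : A → A → A) (_⊛_ : ℝ → A → A) where
    data Comb (G : A → Set) : A → Set where
      nil  : Comb G zeroA
      cons : ∀ {c v y} → 0ℝ ≤ c → G v → Comb G y → Comb G ((c ⊛ v) ⊕ y)

  0V : Vect
  0V _ = 0ℝ
  _+V_ : Vect → Vect → Vect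
  (u +V v) i = u i + v i
  _*V_ : ℝ → Vect → Vect
  (c *V v) i = c * v i

  0M : Mat
  0M _ _ = 0ℝ
  _+M_ : Mat → Mat → Mat
  (X +M Y) a b = X a b + Y a b
  _*M_ : ℝ → Mat → Mat
  (c *M X) a b = c * X a b
  -M_ : Mat → Mat
  (-M X) a b = - X a b

  ΣM : (n : ℕ) → (Fin n → Mat) → Mat
  ΣM n f a b = Σℝ n (λ i → f i a b)

  coneV : (Vect → Set) → Vect → Set
  coneV G x = ∃ λ z → Conic.Comb 0V _+V_ _*V_ G z × (∀ i → z i ≡ x i)

  coneM : (Mat → Set) → Mat → Set
  coneM G X = ∃ λ Z → Conic.Comb 0M _+M_ _*M_ G Z × (∀ a b → Z a b ≡ X a b)

  IsConvexCone : (Vect → Set) → Set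
  IsConvexCone C = C 0V × (∀ x y → C x → C y → C (x +V y))
                        × (∀ c x → 0ℝ ≤ c → C x → C (c *V x))

  dual : (Vect → Set) → Vect → Set
  dual C s = ∀ x → C x → 0ℝ ≤ s · x

  QGen : Vect → Set
  QGen v = v zero ≡ 1ℝ × (∀ i → v (suc i) ≡ 0ℝ ⊎ v (suc i) ≡ 1ℝ)

  Q : Vect → Set
  Q = coneV QGen

  Symmetric : Mat → Set
  Symmetric Y = ∀ a b → Y a b ≡ Y b a

  bilin : Vect → Mat → Vect → ℝ
  bilin u Y v = Σℝ (suc d) (λ a → Σℝ (suc d) (λ b → u a * Y a b * v b))

  PSD : Mat → Set
  PSD Y = Symmetric Y × (∀ x → 0ℝ ≤ bilin x Y x)

  M : (Vect → Set) → Mat → Set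
  M K Y = Symmetric Y
        × (∀ i → Y i zero ≡ Y i i)
        × (∀ u v → dual Q u → dual K v → 0ℝ ≤ bilin u Y v)

  M₊ : (Vect → Set) → Mat → Set
  M₊ K Y = M K Y × PSD Y

  N : (Vect → Set) → Vect → Set
  N K x = ∃ λ Y → M K Y × (∀ i → x i ≡ Y i i)

  N₊ : (Vect → Set) → Vect → Set
  N₊ K x = ∃ λ Y → M₊ K Y × (∀ i → x i ≡ Y i i)

  iter : ℕ → ((Vect → Set) → Vect → Set) → (Vect → Set) → Vect → Set
  iter zero    F K = K
  iter (suc r) F K = F (iter r F K)

  Nʳ : ℕ → (Vect → Set) → Vect → Set
  Nʳ r = iter r N

  N₊ʳ : ℕ → (Vect → Set) → Vect → Set
  N₊ʳ r = iter r N₊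

  TGen : (Vect → Set) → Mat → Set
  TGen K X = ∃ λ u → ∃ λ v → dual Q u × dual K v
           × (∀ a b → X a b ≡ u a * v b + v a * u b)

  T : (Vect → Set) → Mat → Set
  T K = coneM (TGen K)

  E : Idx → Idx → Mat
  E i j a b = e i a * e j b + e j a * e i b

  Dperp : Mat → Set
  Dperp X = ∃ λ (α : Fin d → ℝ) →
    ∀ a b → X a b ≡ ΣM d (λ i → α i *M (E (suc i) (suc i) +M (-M E zero (suc i)))) a b

{-# OPTIONS --safe #-}
-- For Y ∈ M(K) the functional X ↦ ⟨Y, X⟩ is nonnegative on T(K), since
-- ⟨Y, uvᵀ + vuᵀ⟩ = 2 uᵀYv, and vanishes on D^⊥, since Ye₀ = diag(Y). Writing
-- xxᵀ ∈ T(K) + D^⊥ then gives xᵀYx = ⟨Y, xxᵀ⟩ ≥ 0, so every Y ∈ M(K) is PSD.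
-- Because e₀ ∈ Q*, each iterate satisfies K* ⊆ N^r(K)*, hence
-- M(N^r(K)) ⊆ M(K) consists of PSD matrices as well, and N₊^r(K) = N^r(K)
-- follows by induction on r.
module Submission where

open import Defs
open import Level using (0ℓ)
open import Data.Nat using (ℕ; zero; suc)
open import Data.Fin using (Fin; zero; suc; _≟_)
open import Data.Bool using (if_then_else_)
open import Data.Product using (∃; _×_; _,_)
open import Data.Sum using (inj₁; inj₂)
open import Function using (id; _∘_)
open import Relation.Nullary using (does)
open import Relation.Unary using (_⊆′_; _≐′_)
open import Relation.Binary.PropositionalEquality
open import Relation.Binary.Structures using (IsTotalOrder)
open import Algebra.Bundles using (CommutativeRing)

module RealFieldProperties (R : RealField) where
  open RealField R
  open IsTotalOrder isTotalOrder using (total) renaming (trans to ≤-trans)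

  commutativeRing : CommutativeRing 0ℓ 0ℓ
  commutativeRing = record { isCommutativeRing = isCommutativeRing }

  open CommutativeRing commutativeRing using (+-identityˡ; *-identityˡ; -‿inverseʳ; ring)
  open import Algebra.Properties.Ring ring using (-‿distribˡ-*; -‿distribʳ-*; -‿involutive)

  +-nonneg : ∀ {x y} → 0ℝ ≤ x → 0ℝ ≤ y → 0ℝ ≤ x + y
  +-nonneg {x} {y} 0≤x 0≤y = ≤-trans 0≤y (subst (_≤ x + y) (+-identityˡ y) (+-mono-≤ y 0≤x))

  -x*-x≡x*x : ∀ x → - x * - x ≡ x * x
  -x*-x≡x*x x = begin
    - x * - x       ≡⟨ sym (-‿distribˡ-* x (- x)) ⟩
    - (x * - x)     ≡⟨ cong -_ (sym (-‿distribʳ-* x x)) ⟩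
    - (- (x * x))   ≡⟨ -‿involutive (x * x) ⟩
    x * x           ∎
    where open ≡-Reasoning

  square-nonneg : ∀ x → 0ℝ ≤ x * x
  square-nonneg x with total 0ℝ x
  ... | inj₁ 0≤x = *-nonneg 0≤x 0≤x
  ... | inj₂ x≤0 = subst (0ℝ ≤_) (-x*-x≡x*x x) (*-nonneg 0≤-x 0≤-x)
    where
    0≤-x : 0ℝ ≤ - x
    0≤-x = subst₂ _≤_ (-‿inverseʳ x) (+-identityˡ (- x)) (+-mono-≤ (- x) x≤0)

  0≤1 : 0ℝ ≤ 1ℝ
  0≤1 = subst (0ℝ ≤_) (*-identityˡ 1ℝ) (square-nonneg 1ℝ)

module InnerProduct (R : RealField) where
  open RealField R
  open RealFieldProperties R using (commutativeRing)
  open CommutativeRing commutativeRing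
    using (*-comm; +-identityˡ; +-identityʳ; *-identityˡ; zeroˡ; zeroʳ; distribˡ; semiring; ring; *-commutativeSemigroup)
  open import Algebra.Properties.Semiring.Sum semiring
    using (sum; sum-cong-≗; sum-replicate-zero; ∑-distrib-+; ∑-comm; *-distribˡ-sum; *-distribʳ-sum)
  open import Algebra.Properties.Ring ring using (-1*x≈-x)
  open import Algebra.Properties.CommutativeSemigroup *-commutativeSemigroup
    using (interchange; x∙yz≈y∙xz; xy∙z≈y∙xz)
  open ≡-Reasoning

  Matrix : ℕ → ℕ → Set
  Matrix m n = Fin m → Fin n → ℝ

  -- At n = suc d, δ i is definitionally the unit vector e i.
  δ : ∀ {n} → Fin n → Fin n → ℝ
  δ i j = if does (i ≟ j) then 1ℝ else 0ℝ

  ∑-δ : ∀ {n} (i : Fin n) (f : Fin n → ℝ) → sum (λ j → δ i j * f j) ≡ f i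
  ∑-δ {suc n} zero f = begin
    1ℝ * f zero + sum (λ j → 0ℝ * f (suc j))  ≡⟨ cong₂ _+_ (*-identityˡ (f zero)) (sum-cong-≗ (zeroˡ ∘ f ∘ suc)) ⟩
    f zero + sum {n} (λ _ → 0ℝ)                ≡⟨ cong (f zero +_) (sum-replicate-zero n) ⟩
    f zero + 0ℝ                                ≡⟨ +-identityʳ (f zero) ⟩
    f zero                                     ∎
  ∑-δ {suc n} (suc i) f = trans (cong₂ _+_ (zeroˡ (f zero)) (∑-δ i (f ∘ suc))) (+-identityˡ (f (suc i)))

  ⟪_,_⟫ : ∀ {m n} → Matrix m n → Matrix m n → ℝ
  ⟪ Y , X ⟫ = sum λ a → sum λ b → Y a b * X a b

  outer : ∀ {m n} → (Fin m → ℝ) → (Fin n → ℝ) → Matrix m n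
  outer u v a b = u a * v b

  module _ {m n : ℕ} (Y : Matrix m n) where

    ⟪⟫-congʳ : ∀ {X X′ : Matrix m n} → (∀ a b → X a b ≡ X′ a b) → ⟪ Y , X ⟫ ≡ ⟪ Y , X′ ⟫
    ⟪⟫-congʳ X≗X′ = sum-cong-≗ {m} λ a → sum-cong-≗ {n} λ b → cong (Y a b *_) (X≗X′ a b)

    ⟪⟫-zeroʳ : ⟪ Y , (λ _ _ → 0ℝ) ⟫ ≡ 0ℝ
    ⟪⟫-zeroʳ = begin
      ⟪ Y , (λ _ _ → 0ℝ) ⟫                    ≡⟨ sum-cong-≗ {m} (λ a → sum-cong-≗ {n} (zeroʳ ∘ Y a)) ⟩
      sum {m} (λ _ → sum {n} (λ _ → 0ℝ))      ≡⟨ sum-cong-≗ {m} (λ _ → sum-replicate-zero n) ⟩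
      sum {m} (λ _ → 0ℝ)                      ≡⟨ sum-replicate-zero m ⟩
      0ℝ                                      ∎

    ⟪⟫-+ : ∀ X X′ → ⟪ Y , (λ a b → X a b + X′ a b) ⟫ ≡ ⟪ Y , X ⟫ + ⟪ Y , X′ ⟫
    ⟪⟫-+ X X′ = trans (sum-cong-≗ {m} λ a → trans (sum-cong-≗ {n} λ b → distribˡ (Y a b) (X a b) (X′ a b))
                                                  (∑-distrib-+ {n} _ _))
                      (∑-distrib-+ {m} _ _)

    ⟪⟫-* : ∀ c X → ⟪ Y , (λ a b → c * X a b) ⟫ ≡ c * ⟪ Y , X ⟫
    ⟪⟫-* c X = trans (sum-cong-≗ {m} λ a → trans (sum-cong-≗ {n} λ b → x∙yz≈y∙xz (Y a b) c (X a b))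
                                                 (sym (*-distribˡ-sum {n} c _)))
                     (sym (*-distribˡ-sum {m} c _))

    ⟪⟫-neg : ∀ X → ⟪ Y , (λ a b → - X a b) ⟫ ≡ - ⟪ Y , X ⟫
    ⟪⟫-neg X = begin
      ⟪ Y , (λ a b → - X a b) ⟫        ≡⟨ ⟪⟫-congʳ (λ a b → sym (-1*x≈-x (X a b))) ⟩
      ⟪ Y , (λ a b → - 1ℝ * X a b) ⟫   ≡⟨ ⟪⟫-* (- 1ℝ) X ⟩
      - 1ℝ * ⟪ Y , X ⟫                 ≡⟨ -1*x≈-x ⟪ Y , X ⟫ ⟩
      - ⟪ Y , X ⟫                      ∎

  ⟪⟫-outer : ∀ {m n} (Y : Matrix m n) u v → ⟪ Y , outer u v ⟫ ≡ sum (λ a → sum λ b → u a * Y a b * v b)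
  ⟪⟫-outer {m} {n} Y u v = sum-cong-≗ {m} λ a → sum-cong-≗ {n} λ b → sym (xy∙z≈y∙xz (u a) (Y a b) (v b))

  ⟪⟫-outer-swap : ∀ {n} {Y : Matrix n n} → (∀ a b → Y a b ≡ Y b a) →
                  ∀ u v → ⟪ Y , outer v u ⟫ ≡ ⟪ Y , outer u v ⟫
  ⟪⟫-outer-swap {n} Ysym u v =
    trans (∑-comm {n} {n} _) (sum-cong-≗ {n} λ b → sum-cong-≗ {n} λ a → cong₂ _*_ (Ysym a b) (*-comm (v a) (u b)))

  ⟪outer,outer⟫ : ∀ {m n} (x u : Fin m → ℝ) (y v : Fin n → ℝ) →
                  ⟪ outer x y , outer u v ⟫ ≡ sum (λ a → x a * u a) * sum (λ b → y b * v b)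
  ⟪outer,outer⟫ {m} {n} x u y v = begin
    sum (λ a → sum λ b → x a * y b * (u a * v b))
      ≡⟨ sum-cong-≗ {m} (λ a → trans (sum-cong-≗ {n} λ b → interchange (x a) (y b) (u a) (v b))
                                     (sym (*-distribˡ-sum {n} (x a * u a) _))) ⟩
    sum (λ a → x a * u a * sum λ b → y b * v b)
      ≡⟨ sym (*-distribʳ-sum {m} _ _) ⟩
    sum (λ a → x a * u a) * sum (λ b → y b * v b)
      ∎

  ⟪⟫-outer-δˡ : ∀ {m n} (Y : Matrix m n) i v → ⟪ Y , outer (δ i) v ⟫ ≡ sum (λ b → Y i b * v b)
  ⟪⟫-outer-δˡ {m} {n} Y i v = begin
    sum (λ a → sum λ b → Y a b * (δ i a * v b))
      ≡⟨ sum-cong-≗ {m} (λ a → trans (sum-cong-≗ {n} λ b → x∙yz≈y∙xz (Y a b) (δ i a) (v b))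
                                     (sym (*-distribˡ-sum {n} (δ i a) _))) ⟩
    sum (λ a → δ i a * sum λ b → Y a b * v b)
      ≡⟨ ∑-δ i _ ⟩
    sum (λ b → Y i b * v b)
      ∎

  ⟪⟫-outer-δ : ∀ {m n} (Y : Matrix m n) i j → ⟪ Y , outer (δ i) (δ j) ⟫ ≡ Y i j
  ⟪⟫-outer-δ {n = n} Y i j =
    trans (⟪⟫-outer-δˡ Y i (δ j)) (trans (sum-cong-≗ {n} λ b → *-comm (Y i b) (δ j b)) (∑-δ j (Y i)))

module ConeProperties (R : RealField) (d : ℕ) where
  open Cones R d
  open RealFieldProperties R
  open InnerProduct R
  open IsTotalOrder isTotalOrder using () renaming (refl to ≤-refl)
  open CommutativeRing commutativeRing using (*-comm; +-identityʳ; zeroʳ; -‿inverseʳ; semiring)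
  open import Algebra.Properties.Semiring.Sum semiring using (sum; sum-cong-≗; sum-replicate-zero)
  open ≡-Reasoning

  Σℝ≡sum : ∀ n (f : Fin n → ℝ) → Σℝ n f ≡ sum f
  Σℝ≡sum zero    f = refl
  Σℝ≡sum (suc n) f = cong (f zero +_) (Σℝ≡sum n (f ∘ suc))

  Σℝ²≡sum² : ∀ {m n} (f : Fin m → Fin n → ℝ) → Σℝ m (λ a → Σℝ n (f a)) ≡ sum (λ a → sum (f a))
  Σℝ²≡sum² {m} {n} f = trans (Σℝ≡sum m _) (sum-cong-≗ {m} λ a → Σℝ≡sum n (f a))

  ·≡sum : ∀ u v → u · v ≡ sum (λ i → u i * v i)
  ·≡sum u v = Σℝ≡sum (suc d) (λ i → u i * v i)

  bilin≡⟪⟫ : ∀ u Y v → bilin u Y v ≡ ⟪ Y , outer u v ⟫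
  bilin≡⟪⟫ u Y v = trans (Σℝ²≡sum² (λ a b → u a * Y a b * v b)) (sym (⟪⟫-outer Y u v))

  ⟪⟫-ΣM : ∀ (Y : Mat) n (F : Fin n → Mat) → ⟪ Y , ΣM n F ⟫ ≡ Σℝ n (λ i → ⟪ Y , F i ⟫)
  ⟪⟫-ΣM Y zero    F = ⟪⟫-zeroʳ Y
  ⟪⟫-ΣM Y (suc n) F =
    trans (⟪⟫-+ Y (F zero) (ΣM n (F ∘ suc))) (cong (⟪ Y , F zero ⟫ +_) (⟪⟫-ΣM Y n (F ∘ suc)))

  ⟪⟫-E : ∀ (Y : Mat) i j → ⟪ Y , E i j ⟫ ≡ Y i j + Y j i
  ⟪⟫-E Y i j =
    trans (⟪⟫-+ Y (outer (e i) (e j)) (outer (e j) (e i))) (cong₂ _+_ (⟪⟫-outer-δ Y i j) (⟪⟫-outer-δ Y j i))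

  outer-PSD : ∀ x → PSD (outer x x)
  outer-PSD x = (λ a b → *-comm (x a) (x b)) , λ z →
    subst (0ℝ ≤_) (sym (xᵀzzᵀx z)) (square-nonneg (x · z))
    where
    xᵀzzᵀx : ∀ z → bilin z (outer x x) z ≡ (x · z) * (x · z)
    xᵀzzᵀx z = begin
      bilin z (outer x x) z                          ≡⟨ bilin≡⟪⟫ z (outer x x) z ⟩
      ⟪ outer x x , outer z z ⟫                      ≡⟨ ⟪outer,outer⟫ x z x z ⟩
      sum (λ a → x a * z a) * sum (λ b → x b * z b)  ≡⟨ sym (cong₂ _*_ (·≡sum x z) (·≡sum x z)) ⟩
      (x · z) * (x · z)                              ∎

  ⟪⟫-Comb-nonneg : ∀ {G Y Z} → (∀ X → G X → 0ℝ ≤ ⟪ Y , X ⟫) → Conic.Comb 0M _+M_ _*M_ G Z → 0ℝ ≤ ⟪ Y , Z ⟫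
  ⟪⟫-Comb-nonneg {Y = Y} G-nonneg Conic.nil = subst (0ℝ ≤_) (sym (⟪⟫-zeroʳ Y)) ≤-refl
  ⟪⟫-Comb-nonneg {Y = Y} G-nonneg (Conic.cons {c} {X} {Z} 0≤c GX Z∈cone) =
    subst (0ℝ ≤_) (sym (trans (⟪⟫-+ Y (c *M X) Z) (cong (_+ ⟪ Y , Z ⟫) (⟪⟫-* Y c X))))
      (+-nonneg (*-nonneg 0≤c (G-nonneg X GX)) (⟪⟫-Comb-nonneg {Y = Y} G-nonneg Z∈cone))

  ⟪⟫-T-nonneg : ∀ {K Y} → M K Y → ∀ {A} → T K A → 0ℝ ≤ ⟪ Y , A ⟫
  ⟪⟫-T-nonneg {K} {Y} (Ysym , _ , Ypos) (Z , Z∈cone , Z≗A) =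
    subst (0ℝ ≤_) (⟪⟫-congʳ Y Z≗A) (⟪⟫-Comb-nonneg {Y = Y} TGen-nonneg Z∈cone)
    where
    TGen-nonneg : ∀ X → TGen K X → 0ℝ ≤ ⟪ Y , X ⟫
    TGen-nonneg X (u , v , u∈Q* , v∈K* , X≗uvᵀ+vuᵀ) =
      subst (0ℝ ≤_) (sym ⟪Y,X⟫≡2uᵀYv) (+-nonneg uᵀYv≥0 uᵀYv≥0)
      where
      uᵀYv≥0 : 0ℝ ≤ bilin u Y v
      uᵀYv≥0 = Ypos u v u∈Q* v∈K*
      ⟪Y,X⟫≡2uᵀYv : ⟪ Y , X ⟫ ≡ bilin u Y v + bilin u Y v
      ⟪Y,X⟫≡2uᵀYv = begin
        ⟪ Y , X ⟫                                   ≡⟨ ⟪⟫-congʳ Y X≗uvᵀ+vuᵀ ⟩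
        ⟪ Y , outer u v +M outer v u ⟫              ≡⟨ ⟪⟫-+ Y (outer u v) (outer v u) ⟩
        ⟪ Y , outer u v ⟫ + ⟪ Y , outer v u ⟫       ≡⟨ cong (⟪ Y , outer u v ⟫ +_) (⟪⟫-outer-swap Ysym u v) ⟩
        ⟪ Y , outer u v ⟫ + ⟪ Y , outer u v ⟫       ≡⟨ sym (cong₂ _+_ (bilin≡⟪⟫ u Y v) (bilin≡⟪⟫ u Y v)) ⟩
        bilin u Y v + bilin u Y v                   ∎

  ⟪⟫-Dperp : ∀ {K Y} → M K Y → ∀ {B} → Dperp B → ⟪ Y , B ⟫ ≡ 0ℝ
  ⟪⟫-Dperp {Y = Y} (Ysym , Ydiag , _) {B} (α , B≗ΣF) = begin
    ⟪ Y , B ⟫                       ≡⟨ ⟪⟫-congʳ Y B≗ΣF ⟩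
    ⟪ Y , ΣM d F ⟫                  ≡⟨ ⟪⟫-ΣM Y d F ⟩
    Σℝ d (λ i → ⟪ Y , F i ⟫)        ≡⟨ Σℝ≡sum d _ ⟩
    sum (λ i → ⟪ Y , F i ⟫)         ≡⟨ sum-cong-≗ {d} ⟪Y,F⟫≡0 ⟩
    sum {d} (λ _ → 0ℝ)              ≡⟨ sum-replicate-zero d ⟩
    0ℝ                              ∎
    where
    F : Fin d → Mat
    F i = α i *M (E (suc i) (suc i) +M (-M E zero (suc i)))

    ⟪Y,E₀ᵢ⟫≡⟪Y,Eᵢᵢ⟫ : ∀ i → ⟪ Y , E zero i ⟫ ≡ ⟪ Y , E i i ⟫
    ⟪Y,E₀ᵢ⟫≡⟪Y,Eᵢᵢ⟫ i = begin
      ⟪ Y , E zero i ⟫    ≡⟨ ⟪⟫-E Y zero i ⟩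
      Y zero i + Y i zero  ≡⟨ cong₂ _+_ (trans (Ysym zero i) (Ydiag i)) (Ydiag i) ⟩
      Y i i + Y i i        ≡⟨ sym (⟪⟫-E Y i i) ⟩
      ⟪ Y , E i i ⟫        ∎

    ⟪Y,F⟫≡0 : ∀ i → ⟪ Y , F i ⟫ ≡ 0ℝ
    ⟪Y,F⟫≡0 i = begin
      ⟪ Y , F i ⟫                              ≡⟨ ⟪⟫-* Y (α i) (Eᵢᵢ +M (-M E₀ᵢ)) ⟩
      α i * ⟪ Y , Eᵢᵢ +M (-M E₀ᵢ) ⟫            ≡⟨ cong (α i *_) (⟪⟫-+ Y Eᵢᵢ (-M E₀ᵢ)) ⟩
      α i * (⟪ Y , Eᵢᵢ ⟫ + ⟪ Y , -M E₀ᵢ ⟫)     ≡⟨ cong (λ t → α i * (⟪ Y , Eᵢᵢ ⟫ + t)) ⟪Y,-E₀ᵢ⟫ ⟩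
      α i * (⟪ Y , Eᵢᵢ ⟫ + - ⟪ Y , Eᵢᵢ ⟫)      ≡⟨ cong (α i *_) (-‿inverseʳ _) ⟩
      α i * 0ℝ                                 ≡⟨ zeroʳ (α i) ⟩
      0ℝ                                       ∎
      where
      Eᵢᵢ E₀ᵢ : Mat
      Eᵢᵢ = E (suc i) (suc i)
      E₀ᵢ = E zero (suc i)
      ⟪Y,-E₀ᵢ⟫ : ⟪ Y , -M E₀ᵢ ⟫ ≡ - ⟪ Y , Eᵢᵢ ⟫
      ⟪Y,-E₀ᵢ⟫ = trans (⟪⟫-neg Y E₀ᵢ) (cong -_ (⟪Y,E₀ᵢ⟫≡⟪Y,Eᵢᵢ⟫ (suc i)))

  PSD⊆T+D⊥ : (Vect → Set) → Set
  PSD⊆T+D⊥ K = ∀ X → PSD X → ∃ λ A → ∃ λ B → T K A × Dperp B × (∀ a b → X a b ≡ A a b + B a b)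

  M⊆PSD : ∀ {K} → PSD⊆T+D⊥ K → M K ⊆′ PSD
  M⊆PSD {K} cover Y Y∈M@(Ysym , _ , _) = Ysym , λ x → xᵀYx-nonneg x (cover (outer x x) (outer-PSD x))
    where
    xᵀYx-nonneg : ∀ x → (∃ λ A → ∃ λ B → T K A × Dperp B × (∀ a b → outer x x a b ≡ A a b + B a b)) →
                  0ℝ ≤ bilin x Y x
    xᵀYx-nonneg x (A , B , A∈T , B∈D⊥ , xxᵀ≗A+B) = subst (0ℝ ≤_) (sym xᵀYx≡⟪Y,A⟫) (⟪⟫-T-nonneg Y∈M A∈T)
      where
      xᵀYx≡⟪Y,A⟫ : bilin x Y x ≡ ⟪ Y , A ⟫
      xᵀYx≡⟪Y,A⟫ = begin
        bilin x Y x              ≡⟨ bilin≡⟪⟫ x Y x ⟩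
        ⟪ Y , outer x x ⟫        ≡⟨ ⟪⟫-congʳ Y xxᵀ≗A+B ⟩
        ⟪ Y , A +M B ⟫           ≡⟨ ⟪⟫-+ Y A B ⟩
        ⟪ Y , A ⟫ + ⟪ Y , B ⟫    ≡⟨ cong (⟪ Y , A ⟫ +_) (⟪⟫-Dperp Y∈M B∈D⊥) ⟩
        ⟪ Y , A ⟫ + 0ℝ           ≡⟨ +-identityʳ _ ⟩
        ⟪ Y , A ⟫                ∎

  Q-Comb-nonneg₀ : ∀ {z} → Conic.Comb 0V _+V_ _*V_ QGen z → 0ℝ ≤ z zero
  Q-Comb-nonneg₀ Conic.nil = ≤-refl
  Q-Comb-nonneg₀ (Conic.cons 0≤c (v₀≡1 , _) z∈cone) =
    +-nonneg (*-nonneg 0≤c (subst (0ℝ ≤_) (sym v₀≡1) 0≤1)) (Q-Comb-nonneg₀ z∈cone)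

  e₀∈Q* : dual Q (e zero)
  e₀∈Q* q (z , z∈cone , z≗q) =
    subst (0ℝ ≤_) (trans (z≗q zero) (sym (trans (·≡sum (e zero) q) (∑-δ zero q)))) (Q-Comb-nonneg₀ z∈cone)

  dual⊆dual-N : ∀ A → dual A ⊆′ dual (N A)
  dual⊆dual-N A v v∈A* x (Y , (Ysym , Ydiag , Ypos) , x≗diagY) =
    subst (0ℝ ≤_) e₀ᵀYv≡v·x (Ypos (e zero) v e₀∈Q* v∈A*)
    where
    Y₀≗x : ∀ b → Y zero b ≡ x b
    Y₀≗x b = trans (Ysym zero b) (trans (Ydiag b) (sym (x≗diagY b)))

    e₀ᵀYv≡v·x : bilin (e zero) Y v ≡ v · x
    e₀ᵀYv≡v·x = begin
      bilin (e zero) Y v           ≡⟨ bilin≡⟪⟫ (e zero) Y v ⟩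
      ⟪ Y , outer (e zero) v ⟫     ≡⟨ ⟪⟫-outer-δˡ Y zero v ⟩
      sum (λ b → Y zero b * v b)   ≡⟨ sum-cong-≗ {suc d} {λ b → Y zero b * v b} {λ b → v b * x b}
                                        (λ b → trans (cong (_* v b) (Y₀≗x b)) (*-comm (x b) (v b))) ⟩
      sum (λ b → v b * x b)        ≡⟨ sym (·≡sum v x) ⟩
      v · x                        ∎

  dual⊆dual-Nʳ : ∀ r K → dual K ⊆′ dual (Nʳ r K)
  dual⊆dual-Nʳ zero    K v v∈K* = v∈K*
  dual⊆dual-Nʳ (suc r) K v v∈K* = dual⊆dual-N (Nʳ r K) v (dual⊆dual-Nʳ r K v v∈K*)

  dual-antitone : ∀ {A B : Vect → Set} → A ⊆′ B → dual B ⊆′ dual A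
  dual-antitone A⊆B v v∈B* x x∈A = v∈B* x (A⊆B x x∈A)

  M-antitone : ∀ {A B} → dual A ⊆′ dual B → M B ⊆′ M A
  M-antitone A*⊆B* Y (Ysym , Ydiag , Ypos) = Ysym , Ydiag , λ u v u∈Q* v∈A* → Ypos u v u∈Q* (A*⊆B* v v∈A*)

  N-mono : ∀ {A B} → A ⊆′ B → N A ⊆′ N B
  N-mono A⊆B x (Y , Y∈M , x≗diagY) = Y , M-antitone (dual-antitone A⊆B) Y Y∈M , x≗diagY

  N₊-mono : ∀ {A B} → A ⊆′ B → N₊ A ⊆′ N₊ B
  N₊-mono A⊆B x (Y , (Y∈M , Y⪰0) , x≗diagY) = Y , (M-antitone (dual-antitone A⊆B) Y Y∈M , Y⪰0) , x≗diagY

  N₊⊆N : ∀ A → N₊ A ⊆′ N A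
  N₊⊆N A x (Y , (Y∈M , _) , x≗diagY) = Y , Y∈M , x≗diagY

  N⊆N₊ : ∀ {K A} → PSD⊆T+D⊥ K → dual K ⊆′ dual A → N A ⊆′ N₊ A
  N⊆N₊ cover K*⊆A* x (Y , Y∈M , x≗diagY) = Y , (Y∈M , M⊆PSD cover Y (M-antitone K*⊆A* Y Y∈M)) , x≗diagY

  N₊ʳ≐Nʳ : ∀ {K} → PSD⊆T+D⊥ K → ∀ r → N₊ʳ r K ≐′ Nʳ r K
  N₊ʳ≐Nʳ cover zero = (λ _ → id) , (λ _ → id)
  N₊ʳ≐Nʳ {K} cover (suc r) with N₊ʳ≐Nʳ cover r
  ... | N₊ʳ⊆Nʳ , Nʳ⊆N₊ʳ =
    (λ x → N-mono N₊ʳ⊆Nʳ x ∘ N₊⊆N (N₊ʳ r K) x) ,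
    (λ x → N₊-mono Nʳ⊆N₊ʳ x ∘ N⊆N₊ cover (dual⊆dual-Nʳ r K) x)

corollary6p2 : (R : RealField) (d : ℕ) → let open Cones R d in
    (K : Vect → Set) → IsConvexCone K → (∀ x → K x → Q x) →
    (∀ X → PSD X → ∃ λ A → ∃ λ B → T K A × Dperp B × (∀ a b → X a b ≡ A a b + B a b)) →
    ∀ (r : ℕ) x → (N₊ʳ r K x → Nʳ r K x) × (Nʳ r K x → N₊ʳ r K x)
corollary6p2 R d K _ _ cover r x with ConeProperties.N₊ʳ≐Nʳ R d cover r
... | N₊ʳ⊆Nʳ , Nʳ⊆N₊ʳ = N₊ʳ⊆Nʳ x , Nʳ⊆N₊ʳ x
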